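{- Let $G_0,G_1\in\mathbb{Z}$ and let $(G_n)_{n\ge0}$ satisfy $G_n=G_{n-1}+G_{n-2}$ for $n\ge2$. Set $\Delta_{G_0,G_1}=\gcd(G_0+G_2,\,G_1+G_3)$. If $k$ is a positive integer with $k\equiv 0,4,8\pmod{12}$, then $$\gcd(G_{k+1}-G_1,\,G_{k+2}-G_2)=\Delta_{G_0,G_1}\cdot F_{k/2}.$$ In particular, $\mathcal{F}(k)=F_{k/2}$, $\mathcal{L}(k)=5F_{k/2}$, and $\mathcal{G}_{G_0,G_1}(k)=\Delta_{G_0,G_1}\cdot F_{k/2}$.
   Context: $F_n$ denotes the Fibonacci numbers ($F_0=0$, $F_1=1$, $F_n=F_{n-1}+F_{n-2}$) and $L_n$ the Lucas numbers ($L_0=2$, $L_1=1$, $L_n=L_{n-1}+L_{n-2}$). For a positive integer $k$, $\mathcal{G}_{G_0,G_1}(k)$ is the greatest common divisor of all integers $\sum_{i=0}^{k-1}G_{n+i}$, $n\ge1$; $\mathcal{F}(k)$ and $\mathcal{L}(k)$ denote this quantity for the Fibonacci sequence ($G_0=0,G_1=1$) and the Lucas sequence ($G_0=2,G_1=1$), respectively. -}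

module Defs where

open import Data.Nat using (ℕ; zero; suc; _≥_)
open import Data.Integer using (ℤ; +_; _+_)
open import Data.Integer.Divisibility using (_∣_)
open import Data.Integer.GCD using (gcd)
open import Data.Product using (_×_)

fib : ℕ → ℕ
fib zero = 0
fib (suc zero) = 1
fib (suc (suc n)) = fib n Data.Nat.+ fib (suc n)

gibonacci : ℤ → ℤ → ℕ → ℤ
gibonacci a b zero = a
gibonacci a b (suc zero) = b
gibonacci a b (suc (suc n)) = gibonacci a b n + gibonacci a b (suc n)

fibSeq : ℕ → ℤ
fibSeq = gibonacci (+ 0) (+ 1)

lucSeq : ℕ → ℤ
lucSeq = gibonacci (+ 2) (+ 1)

IsGibonacci : (ℕ → ℤ) → Set
IsGibonacci G = ∀ n → G (suc (suc n)) ≡ G (suc n) + G n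
  where open import Relation.Binary.PropositionalEquality using (_≡_)

windowSum : (ℕ → ℤ) → ℕ → ℕ → ℤ
windowSum G n zero = + 0
windowSum G n (suc k) = G n + windowSum (λ m → G (suc m)) n k

Δ : (ℕ → ℤ) → ℤ
Δ G = gcd (G 0 + G 2) (G 1 + G 3)

-- d is the (nonnegative) greatest common divisor of all the integers
-- Σ_{i=0}^{k-1} G_{n+i}, n ≥ 1 ; i.e. d = 𝒢_{G0,G1}(k)
IsSumGcd : (ℕ → ℤ) → ℕ → ℤ → Set
IsSumGcd G k d =
  (NonNeg d) × (∀ n → n ≥ 1 → d ∣ windowSum G n k) ×
  (∀ c → (∀ n → n ≥ 1 → c ∣ windowSum G n k) → c ∣ d)
  where
  open import Data.Integer using (_≤_)
  NonNeg : ℤ → Set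
  NonNeg x = + 0 ≤ x

-- Summing k consecutive terms telescopes: Σ_{i<k} G_{n+i} = G_{n+k+1} - G_{n+1}.  For
-- k = 4t the addition formula G_{m+n+1} = F_m G_n + F_{m+1} G_{n+1} together with
-- Cassini's identity at the even index 2t factors this difference as
-- F_{2t} (G_{n+2t} + G_{n+2t+2}).  The bracket is again a Fibonacci-type sequence, so
-- the gcd of two consecutive values is the same for every n, namely
-- gcd(G_0 + G_2, G_1 + G_3) = Δ.
module Submission where

open import Defs
open import Data.Nat using (ℕ; _≥_; _%_; _/_)
open import Data.Integer using (ℤ; +_; _+_; _-_; _*_)
open import Data.Integer.GCD using (gcd)
open import Data.Product using (_×_)
open import Data.Sum using (_⊎_)
open import Relation.Binary.PropositionalEquality using (_≡_)

open import Data.Nat as ℕ using (zero; suc; z≤n; s≤s)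
import Data.Nat.Properties as ℕ
import Data.Nat.DivMod as ℕ
import Data.Nat.GCD as ℕ
import Data.Nat.Divisibility as ℕ
import Data.Nat.Tactic.RingSolver as ℕ-Solver
open import Data.Integer using (_≤_; +≤+; ∣_∣)
open import Data.Integer.Properties using (+-comm; +-inverseʳ; *-identityˡ; abs-*; pos-*; pos-+)
open import Data.Integer.GCD using (gcd[i,j]∣i; gcd[i,j]∣j; gcd-greatest)
open import Data.Integer.Divisibility using () renaming (_∣_ to _∣ᵤ_)
open import Data.Integer.Divisibility.Signed using (_∣_; ∣ᵤ⇒∣; ∣⇒∣ᵤ; ∣m∣n⇒∣m+n; ∣m+n∣m⇒∣n)
open import Data.Integer.Tactic.RingSolver using (solve-∀)
open import Data.Product using (_,_; ∃)
open import Data.Sum using (inj₁; inj₂)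
open import Relation.Binary.PropositionalEquality
  using (refl; sym; trans; cong; cong₂; subst; module ≡-Reasoning)

open ≡-Reasoning

double : ℕ → ℕ
double n = n ℕ.+ n

skipSum : (ℕ → ℤ) → ℕ → ℤ
skipSum G n = G n + G (suc (suc n))

gibonacci-isGibonacci : ∀ a b → IsGibonacci (gibonacci a b)
gibonacci-isGibonacci a b n = +-comm (gibonacci a b n) (gibonacci a b (suc n))

fibSeq-isGibonacci : IsGibonacci fibSeq
fibSeq-isGibonacci = gibonacci-isGibonacci (+ 0) (+ 1)

lucSeq-isGibonacci : IsGibonacci lucSeq
lucSeq-isGibonacci = gibonacci-isGibonacci (+ 2) (+ 1)

fibSeq≡fib : ∀ n → fibSeq n ≡ + fib n
fibSeq≡fib zero = refl
fibSeq≡fib (suc zero) = refl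
fibSeq≡fib (suc (suc n)) = begin
  fibSeq n + fibSeq (suc n)  ≡⟨ cong₂ _+_ (fibSeq≡fib n) (fibSeq≡fib (suc n)) ⟩
  + fib n + + fib (suc n)    ≡⟨ sym (pos-+ (fib n) (fib (suc n))) ⟩
  + fib (suc (suc n))        ∎

gcd[i,j]≡gcd[j,j+i] : ∀ i j → gcd i j ≡ gcd j (j + i)
gcd[i,j]≡gcd[j,j+i] i j = cong +_ (ℕ.∣-antisym
  (gcd-greatest {j} {j + i} {gcd i j} (gcd[i,j]∣j i j) (∣⇒∣ᵤ gcd[i,j]∣j+i))
  (gcd-greatest {i} {j} {gcd j (j + i)} (∣⇒∣ᵤ gcd[j,j+i]∣i) (gcd[i,j]∣i j (j + i))))
  where
  ∣-gcdˡ : ∀ m n → gcd m n ∣ m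
  ∣-gcdˡ m n = ∣ᵤ⇒∣ (gcd[i,j]∣i m n)
  ∣-gcdʳ : ∀ m n → gcd m n ∣ n
  ∣-gcdʳ m n = ∣ᵤ⇒∣ (gcd[i,j]∣j m n)
  gcd[i,j]∣j+i : gcd i j ∣ j + i
  gcd[i,j]∣j+i = ∣m∣n⇒∣m+n (∣-gcdʳ i j) (∣-gcdˡ i j)
  gcd[j,j+i]∣i : gcd j (j + i) ∣ i
  gcd[j,j+i]∣i = ∣m+n∣m⇒∣n (∣-gcdʳ j (j + i)) (∣-gcdˡ j (j + i))

gcd[ci,cj]≡gcd[i,j]*c : ∀ c i j → gcd (+ c * i) (+ c * j) ≡ gcd i j * + c
gcd[ci,cj]≡gcd[i,j]*c c i j = begin
  + ℕ.gcd ∣ + c * i ∣ ∣ + c * j ∣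
    ≡⟨ cong₂ (λ m n → + ℕ.gcd m n) (abs-* (+ c) i) (abs-* (+ c) j) ⟩
  + ℕ.gcd (c ℕ.* ∣ i ∣) (c ℕ.* ∣ j ∣)
    ≡⟨ cong +_ (sym (ℕ.c*gcd[m,n]≡gcd[cm,cn] c ∣ i ∣ ∣ j ∣)) ⟩
  + (c ℕ.* ℕ.gcd ∣ i ∣ ∣ j ∣)
    ≡⟨ cong +_ (ℕ.*-comm c _) ⟩
  + (ℕ.gcd ∣ i ∣ ∣ j ∣ ℕ.* c)
    ≡⟨ pos-* (ℕ.gcd ∣ i ∣ ∣ j ∣) c ⟩
  gcd i j * + c ∎

module Gibonacci (G : ℕ → ℤ) (gG : IsGibonacci G) where

  addition-formula : ∀ m n → G (suc (m ℕ.+ n)) ≡ fibSeq m * G n + fibSeq (suc m) * G (suc n)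
  addition-formula zero n = sym (identity (G n) (G (suc n)))
    where
    identity : ∀ a b → + 0 * a + + 1 * b ≡ b
    identity = solve-∀
  addition-formula (suc zero) n = trans (gG n) (identity (G n) (G (suc n)))
    where
    identity : ∀ a b → b + a ≡ + 1 * a + (+ 0 + + 1) * b
    identity = solve-∀
  addition-formula (suc (suc m)) n = begin
    G (suc (suc (suc (m ℕ.+ n))))
      ≡⟨ gG (suc (m ℕ.+ n)) ⟩
    G (suc (suc (m ℕ.+ n))) + G (suc (m ℕ.+ n))
      ≡⟨ cong₂ _+_ (addition-formula (suc m) n) (addition-formula m n) ⟩
    (q * a + (p + q) * b) + (p * a + q * b)
      ≡⟨ identity p q a b ⟩
    (p + q) * a + (q + (p + q)) * b ∎
    where
    p q a b : ℤ
    p = fibSeq m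
    q = fibSeq (suc m)
    a = G n
    b = G (suc n)
    identity : ∀ p q a b → (q * a + (p + q) * b) + (p * a + q * b) ≡ (p + q) * a + (q + (p + q)) * b
    identity = solve-∀

  skipSum-isGibonacci : IsGibonacci (skipSum G)
  skipSum-isGibonacci j = begin
    G (suc (suc j)) + G (suc (suc (suc (suc j))))
      ≡⟨ cong₂ _+_ (gG j) (gG (suc (suc j))) ⟩
    (G (suc j) + G j) + (G (suc (suc (suc j))) + G (suc (suc j)))
      ≡⟨ cong (λ x → (G (suc j) + G j) + (G (suc (suc (suc j))) + x)) (gG j) ⟩
    (G (suc j) + G j) + (G (suc (suc (suc j))) + (G (suc j) + G j))
      ≡⟨ identity (G j) (G (suc j)) (G (suc (suc (suc j)))) ⟩
    (G (suc j) + G (suc (suc (suc j)))) + (G j + (G (suc j) + G j))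
      ≡⟨ cong (λ x → (G (suc j) + G (suc (suc (suc j)))) + (G j + x)) (sym (gG j)) ⟩
    skipSum G (suc j) + skipSum G j ∎
    where
    identity : ∀ g₀ g₁ g₃ → (g₁ + g₀) + (g₃ + (g₁ + g₀)) ≡ (g₁ + g₃) + (g₀ + (g₁ + g₀))
    identity = solve-∀

  gcd-consecutive-invariant : ∀ j → gcd (G j) (G (suc j)) ≡ gcd (G 0) (G 1)
  gcd-consecutive-invariant zero = refl
  gcd-consecutive-invariant (suc j) = begin
    gcd (G (suc j)) (G (suc (suc j)))      ≡⟨ cong (gcd (G (suc j))) (gG j) ⟩
    gcd (G (suc j)) (G (suc j) + G j)      ≡⟨ sym (gcd[i,j]≡gcd[j,j+i] (G j) (G (suc j))) ⟩
    gcd (G j) (G (suc j))                  ≡⟨ gcd-consecutive-invariant j ⟩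
    gcd (G 0) (G 1)                        ∎

windowSum≡difference : ∀ G → IsGibonacci G → ∀ n k → windowSum G n k ≡ G (k ℕ.+ suc n) - G (suc n)
windowSum≡difference G gG n zero = sym (+-inverseʳ (G (suc n)))
windowSum≡difference G gG n (suc k) = begin
  G n + windowSum (λ m → G (suc m)) n k
    ≡⟨ cong (λ x → G n + x) (windowSum≡difference (λ m → G (suc m)) (λ m → gG (suc m)) n k) ⟩
  G n + (X - G (suc (suc n)))
    ≡⟨ cong (λ x → G n + (X - x)) (gG n) ⟩
  G n + (X - (G (suc n) + G n))
    ≡⟨ identity (G n) (G (suc n)) X ⟩
  X - G (suc n) ∎
  where
  X : ℤ
  X = G (suc (k ℕ.+ suc n))
  identity : ∀ a b x → a + (x - (b + a)) ≡ x - b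
  identity = solve-∀

module Fib = Gibonacci fibSeq fibSeq-isGibonacci

fib-cassini-even : ∀ s → fibSeq (suc (double s)) * fibSeq (suc (double s))
                         ≡ fibSeq (double s) * fibSeq (suc (suc (double s))) + + 1
fib-cassini-even zero = refl
fib-cassini-even (suc s) rewrite ℕ.+-suc s s = begin
  (q + (p + q)) * (q + (p + q))                 ≡⟨ shift p q ⟩
  B + (q * q - p * (p + q))                     ≡⟨ cong (λ x → B + (x - p * (p + q))) (fib-cassini-even s) ⟩
  B + ((p * (p + q) + + 1) - p * (p + q))       ≡⟨ cancel B (p * (p + q)) ⟩
  B + + 1                                       ∎
  where
  p q B : ℤ
  p = fibSeq (double s)
  q = fibSeq (suc (double s))
  B = (p + q) * ((p + q) + (q + (p + q)))
  shift : ∀ p q → (q + (p + q)) * (q + (p + q)) ≡ (p + q) * ((p + q) + (q + (p + q))) + (q * q - p * (p + q))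
  shift = solve-∀
  cancel : ∀ b y → b + ((y + + 1) - y) ≡ b + + 1
  cancel = solve-∀

difference≡fib*skipSum : ∀ G → IsGibonacci G → ∀ t n → let u = double (suc t) in
  G (double u ℕ.+ suc n) - G (suc n) ≡ fibSeq u * skipSum G (u ℕ.+ n)
difference≡fib*skipSum G gG t n = begin
  G (double u ℕ.+ suc n) - b
    ≡⟨ cong (λ m → G m - b) (ℕ.+-suc (double u) n) ⟩
  G (suc (double u ℕ.+ n)) - b
    ≡⟨ cong (_- b) (addition-formula (double u) n) ⟩
  fibSeq (double u) * a + fibSeq (suc (double u)) * b - b
    ≡⟨ cong₂ (λ f f′ → f * a + f′ * b - b) (Fib.addition-formula v u)
                                            (Fib.addition-formula u u) ⟩
  (x * y + y * (x + y)) * a + (y * y + (x + y) * (x + y)) * b - b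
    ≡⟨ cong (λ z → (x * y + y * (x + y)) * a + (y * y + z) * b - b) (fib-cassini-even (suc t)) ⟩
  (x * y + y * (x + y)) * a + (y * y + (y * (y + (x + y)) + + 1)) * b - b
    ≡⟨ factor x y a b ⟩
  y * ((x * a + y * b) + ((x + y) * a + (y + (x + y)) * b))
    ≡⟨ sym (cong (y *_) (cong₂ _+_ (addition-formula v n) (addition-formula (suc u) n))) ⟩
  y * skipSum G (u ℕ.+ n) ∎
  where
  open Gibonacci G gG
  v u : ℕ
  v = t ℕ.+ suc t
  u = suc v
  a b x y : ℤ
  a = G n
  b = G (suc n)
  x = fibSeq v
  y = fibSeq u
  factor : ∀ x y a b → ((x * y + y * (x + y)) * a + (y * y + (y * (y + (x + y)) + + 1)) * b) - b
                       ≡ y * ((x * a + y * b) + ((x + y) * a + (y + (x + y)) * b))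
  factor = solve-∀

difference-gcd : ∀ G → IsGibonacci G → ∀ t n → let u = double (suc t) in
  gcd (G (double u ℕ.+ suc n) - G (suc n)) (G (double u ℕ.+ suc (suc n)) - G (suc (suc n)))
    ≡ Δ G * + fib u
difference-gcd G gG t n = begin
  gcd (G (double u ℕ.+ suc n) - G (suc n)) (G (double u ℕ.+ suc (suc n)) - G (suc (suc n)))
    ≡⟨ cong₂ gcd (scaled n) (scaled (suc n)) ⟩
  gcd (+ f * P (u ℕ.+ n)) (+ f * P (u ℕ.+ suc n))
    ≡⟨ cong (λ m → gcd (+ f * P (u ℕ.+ n)) (+ f * P m)) (ℕ.+-suc u n) ⟩
  gcd (+ f * P (u ℕ.+ n)) (+ f * P (suc (u ℕ.+ n)))
    ≡⟨ gcd[ci,cj]≡gcd[i,j]*c f (P (u ℕ.+ n)) (P (suc (u ℕ.+ n))) ⟩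
  gcd (P (u ℕ.+ n)) (P (suc (u ℕ.+ n))) * + f
    ≡⟨ cong (_* + f) (Gibonacci.gcd-consecutive-invariant P (Gibonacci.skipSum-isGibonacci G gG) (u ℕ.+ n)) ⟩
  Δ G * + f ∎
  where
  u f : ℕ
  u = double (suc t)
  f = fib u
  P : ℕ → ℤ
  P = skipSum G
  scaled : ∀ m → G (double u ℕ.+ suc m) - G (suc m) ≡ + f * P (u ℕ.+ m)
  scaled m = trans (difference≡fib*skipSum G gG t m) (cong (_* P (u ℕ.+ m)) (fibSeq≡fib u))

isSumGcd-fromConsecutiveGcd : ∀ G k d → (∀ n → gcd (windowSum G n k) (windowSum G (suc n) k) ≡ d) →
  IsSumGcd G k d
isSumGcd-fromConsecutiveGcd G k d gcd≡d =
    subst (+ 0 ≤_) (gcd≡d 1) (+≤+ z≤n)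
  , (λ n _ → subst (_∣ᵤ S n) (gcd≡d n) (gcd[i,j]∣i (S n) (S (suc n))))
  , (λ c c∣S → subst (c ∣ᵤ_) (gcd≡d 1) (gcd-greatest {S 1} {S 2} {c} (c∣S 1 (s≤s z≤n)) (c∣S 2 (s≤s z≤n))))
  where
  S : ℕ → ℤ
  S n = windowSum G n k

windowSum-isSumGcd : ∀ G → IsGibonacci G → ∀ t → let u = double (suc t) in
  IsSumGcd G (double u) (Δ G * + fib u)
windowSum-isSumGcd G gG t = isSumGcd-fromConsecutiveGcd G k _ λ n →
  trans (cong₂ gcd (windowSum≡difference G gG n k) (windowSum≡difference G gG (suc n) k))
        (difference-gcd G gG t n)
  where
  k : ℕ
  k = double (double (suc t))

double[n]/2≡n : ∀ n → double n / 2 ≡ n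
double[n]/2≡n n = trans (cong (_/ 2) (n+n≡n*2 n)) (ℕ.m*n/n≡m n 2)
  where
  n+n≡n*2 : ∀ n → n ℕ.+ n ≡ n ℕ.* 2
  n+n≡n*2 = ℕ-Solver.solve-∀

positive-multipleOf4 : ∀ k → k ≥ 1 → (k % 12 ≡ 0 ⊎ k % 12 ≡ 4 ⊎ k % 12 ≡ 8) →
  ∃ λ t → k ≡ double (double (suc t))
positive-multipleOf4 k k≥1 k%12 = split (k % 12) (k / 12) (ℕ.m≡m%n+[m/n]*n k 12) k%12
  where
  r≡0 : ∀ q → 0 ℕ.+ suc q ℕ.* 12 ≡ (suc (2 ℕ.+ 3 ℕ.* q) ℕ.+ suc (2 ℕ.+ 3 ℕ.* q))
                                   ℕ.+ (suc (2 ℕ.+ 3 ℕ.* q) ℕ.+ suc (2 ℕ.+ 3 ℕ.* q))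
  r≡0 = ℕ-Solver.solve-∀
  r≡4 : ∀ q → 4 ℕ.+ q ℕ.* 12 ≡ (suc (3 ℕ.* q) ℕ.+ suc (3 ℕ.* q)) ℕ.+ (suc (3 ℕ.* q) ℕ.+ suc (3 ℕ.* q))
  r≡4 = ℕ-Solver.solve-∀
  r≡8 : ∀ q → 8 ℕ.+ q ℕ.* 12 ≡ (suc (1 ℕ.+ 3 ℕ.* q) ℕ.+ suc (1 ℕ.+ 3 ℕ.* q))
                               ℕ.+ (suc (1 ℕ.+ 3 ℕ.* q) ℕ.+ suc (1 ℕ.+ 3 ℕ.* q))
  r≡8 = ℕ-Solver.solve-∀
  split : ∀ r q → k ≡ r ℕ.+ q ℕ.* 12 → (r ≡ 0 ⊎ r ≡ 4 ⊎ r ≡ 8) → ∃ λ t → k ≡ double (double (suc t))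
  split _ zero    k≡0 (inj₁ refl) with () ← subst (_≥ 1) k≡0 k≥1
  split _ (suc q) k≡r (inj₁ refl)        = 2 ℕ.+ 3 ℕ.* q , trans k≡r (r≡0 q)
  split _ q       k≡r (inj₂ (inj₁ refl)) = 3 ℕ.* q ,       trans k≡r (r≡4 q)
  split _ q       k≡r (inj₂ (inj₂ refl)) = 1 ℕ.+ 3 ℕ.* q , trans k≡r (r≡8 q)

theorem4p7 : (G : ℕ → ℤ) → IsGibonacci G → (k : ℕ) → k ≥ 1 →
    (k % 12 ≡ 0 ⊎ k % 12 ≡ 4 ⊎ k % 12 ≡ 8) →
    (gcd (G (k Data.Nat.+ 1) - G 1) (G (k Data.Nat.+ 2) - G 2) ≡ Δ G * + fib (k / 2))
    × IsSumGcd fibSeq k (+ fib (k / 2))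
    × IsSumGcd lucSeq k (+ 5 * + fib (k / 2))
    × IsSumGcd G k (Δ G * + fib (k / 2))
-- Δ fibSeq and Δ lucSeq compute to 1 and 5.
theorem4p7 G gG k k≥1 k%12 with positive-multipleOf4 k k≥1 k%12
... | t , refl rewrite double[n]/2≡n (double (suc t)) =
    difference-gcd G gG t 0
  , subst (IsSumGcd fibSeq (double (double (suc t)))) (*-identityˡ (+ fib (double (suc t))))
          (windowSum-isSumGcd fibSeq fibSeq-isGibonacci t)
  , windowSum-isSumGcd lucSeq lucSeq-isGibonacci t
  , windowSum-isSumGcd G gG t
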